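{- Let $k\ge1$ and $n$ be integers. (a) If $n\ge 2k$, then the sequence $S_{n,n-k}$ has a $k$-bad sequence of indices only when $n=2k$, and in that case every $k$-bad sequence of indices $i_1,\dots,i_{2r}$ for $S_{2k,k}$ has associated $m$ equal to $2$ and satisfies $m<r$ (i.e. $r>2$). (b) If $n\ge 2k+1$, then $f_k(n)\ge 2n-k$.
   Context: For integers $n>c\ge0$, $S_{n,c}$ denotes the sequence $1,2,\dots,n,1,2,\dots,c$ (of length $n+c$). For a sequence $S=s_1,s_2,\dots$, a sequence of indices $i_1,\dots,i_{2r}$ ($r\ge1$) is $k$-bad for $S$ if there is $m$ with $1<m\le 2r$ (the associated $m$) such that: (a) $s_{i_j}=s_{i_{j+r}}$ for $1\le j\le r$; (b) $i_1>i_2>\dots>i_m<i_{m+1}<\dots<i_{2r}$; (c) $|i_j-i_{j+1}|\le k$ for $1\le j<2r$; (d) $i_{m+1}<i_m+k$ if $m<2r$. $S$ is $k$-special if it has no $k$-bad sequence of indices. $f_k(n)$ denotes the maximum length of a $k$-special sequence whose entries come from a set of $n$ symbols. -}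

module Defs where

open import Data.Nat using (ℕ; suc; _+_; _*_; _∸_; _≤_; _<_; _≤ᵇ_; ∣_-_∣)
open import Data.Bool using (if_then_else_)
open import Data.Product using (_×_)
open import Relation.Binary.PropositionalEquality using (_≡_)
open import Relation.Nullary using (¬_)

-- A (finite) sequence of length L is represented by its length L and a
-- function s : ℕ → A; its entries are s 1, s 2, …, s L (1-based indices).
-- Values of s outside 1..L are irrelevant: every notion below only
-- inspects indices in 1..L.

-- The sequence S_{n,c} = 1,2,…,n,1,2,…,c : entry at position i is i if
-- i ≤ n and i ∸ n otherwise; its length is n + c (see uses below).
S : ℕ → ℕ → ℕ
S n i = if i ≤ᵇ n then i else i ∸ n

KBad : {A : Set} → ℕ → (L : ℕ) → (ℕ → A) → (r : ℕ) → (ℕ → ℕ) → (m : ℕ) → Set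
KBad k L s r i m =
  1 ≤ r × 1 < m × m ≤ 2 * r ×
  (∀ j → 1 ≤ j → j ≤ 2 * r → 1 ≤ i j × i j ≤ L) ×
  -- (a)
  (∀ j → 1 ≤ j → j ≤ r → s (i j) ≡ s (i (j + r))) ×
  -- (b)
  (∀ j → 1 ≤ j → j < m → i (suc j) < i j) ×
  (∀ j → m ≤ j → j < 2 * r → i j < i (suc j)) ×
  -- (c)
  (∀ j → 1 ≤ j → j < 2 * r → ∣ i j - i (suc j) ∣ ≤ k) ×
  -- (d)
  (m < 2 * r → i (suc m) < i m + k)

KSpecial : {A : Set} → ℕ → (L : ℕ) → (ℕ → A) → Set
KSpecial k L s = ∀ r i m → ¬ KBad k L s r i m

-- Two positions a, b of S_{n,c} carry the same symbol exactly when b = a, b = a + n or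
-- a = b + n; call this the shift of the pair.  Along a k-bad sequence the pairs
-- (i_j, i_{j+r}) and (i_{j+1}, i_{j+1+r}) differ by at most k in each coordinate, so they have
-- the same shift when n > 2k, or when both coordinates move in the same direction and n > k.
-- For n > 2k all r pairs therefore share one shift, which the monotone shape of the indices
-- (condition (b)) and the length 2n - k of S_{n,n-k} rule out.  For n = 2k the shift can change only
-- where the coordinates move in opposite directions (j < m ≤ j + r), and then only from down to
-- stay or from stay to up, with both steps of size exactly k; at the turn m ≤ r the shift is
-- up, and counting the possible changes below it leaves m = 2 < r.  For part (b) the symbols of
-- S_{n,n-k} are relabelled injectively in Fin n.

module Submission where

open import Defs
open import Data.Nat using (ℕ; _+_; _*_; _∸_; _≤_; _<_)
open import Data.Fin using (Fin)
open import Data.Product using (_×_; Σ; ∃)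
open import Relation.Binary.PropositionalEquality using (_≡_)

open import Data.Bool using (true; false)
open import Data.Fin using (toℕ)
open import Data.Fin.Properties using (toℕ-fromℕ<)
open import Data.Nat.DivMod using (_mod_; _%_; m<n⇒m%n≡m)
open import Data.Empty using (⊥; ⊥-elim)
open import Data.Nat
  using (zero; suc; pred; NonZero; >-nonZero; z≤n; s≤s; s≤s⁻¹; _≤ᵇ_; ∣_-_∣; _>_; _≤?_)
open import Data.Nat.Properties
open import Data.Product using (_,_; proj₁; proj₂)
open import Data.Sum using (inj₁; inj₂)
open import Relation.Nullary using (yes; no; contradiction)
open import Relation.Nullary.Reflects using (ofʸ; ofⁿ)
open import Relation.Binary.PropositionalEquality
  using (refl; sym; trans; cong; subst; subst₂; module ≡-Reasoning)

∣m-n∣≤k⇒m≤n+k : ∀ m n {k} → ∣ m - n ∣ ≤ k → m ≤ n + k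
∣m-n∣≤k⇒m≤n+k m n h = ≤-trans (m≤n+m∸n m n) (+-monoʳ-≤ n (≤-trans (m∸n≤∣m-n∣ m n) h))

∣m-n∣≤k⇒n≤m+k : ∀ m n {k} → ∣ m - n ∣ ≤ k → n ≤ m + k
∣m-n∣≤k⇒n≤m+k m n {k} h = ∣m-n∣≤k⇒m≤n+k n m (subst (_≤ k) (∣-∣-comm m n) h)

S-low : ∀ {n a} → a ≤ n → S n a ≡ a
S-low {n} {a} a≤n with a ≤ᵇ n | ≤ᵇ-reflects-≤ a n
... | true  | _        = refl
... | false | ofⁿ a≰n = contradiction a≤n a≰n

S-high : ∀ {n a} → n < a → S n a + n ≡ a
S-high {n} {a} n<a with a ≤ᵇ n | ≤ᵇ-reflects-≤ a n
... | true  | ofʸ a≤n = contradiction a≤n (<⇒≱ n<a)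
... | false | _        = m∸n+n≡m (<⇒≤ n<a)

data Shift : Set where
  stay up down : Shift

Shifted : ℕ → Shift → ℕ → ℕ → Set
Shifted n stay a b = a ≡ b
Shifted n up   a b = a + n ≡ b
Shifted n down a b = b + n ≡ a

S-≡⇒Shifted : ∀ n a b → S n a ≡ S n b → ∃ λ t → Shifted n t a b
S-≡⇒Shifted n a b e with a ≤? n | b ≤? n
... | yes a≤n | yes b≤n = stay , trans (sym (S-low a≤n)) (trans e (S-low b≤n))
... | yes a≤n | no  b≰n =
  up , trans (cong (_+ n) (trans (sym (S-low a≤n)) e)) (S-high (≰⇒> b≰n))
... | no  a≰n | yes b≤n =
  down , trans (cong (_+ n) (trans (sym (S-low b≤n)) (sym e))) (S-high (≰⇒> a≰n))
... | no  a≰n | no  b≰n =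
  stay , trans (sym (S-high (≰⇒> a≰n))) (trans (cong (_+ n) e) (S-high (≰⇒> b≰n)))

private
  ≤+k-trans : ∀ {x y z k} → x ≤ y + k → y ≤ z + k → x ≤ z + (k + k)
  ≤+k-trans {x} {z = z} {k} x≤y+k y≤z+k =
    subst (x ≤_) (+-assoc z k k) (≤-trans x≤y+k (+-monoˡ-≤ k y≤z+k))

  +-cancelˡ-≤-contra : ∀ x {c n} → c < n → x + n ≤ x + c → ⊥
  +-cancelˡ-≤-contra x {c} {n} c<n le = <⇒≱ c<n (+-cancelˡ-≤ x n c le)

shift-kept-short-steps : ∀ {n k} t t' {a b a' b'} → Shifted n t a b → Shifted n t' a' b' →
                         ∣ a - a' ∣ ≤ k → ∣ b - b' ∣ ≤ k → k + k < n → t ≡ t'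
shift-kept-short-steps stay stay _ _ _ _ _ = refl
shift-kept-short-steps up   up   _ _ _ _ _ = refl
shift-kept-short-steps down down _ _ _ _ _ = refl
shift-kept-short-steps {n} stay up {a} {a' = a'} refl refl da db lt =
  ⊥-elim (+-cancelˡ-≤-contra a' lt
    (≤+k-trans (∣m-n∣≤k⇒n≤m+k a (a' + n) db) (∣m-n∣≤k⇒m≤n+k a a' da)))
shift-kept-short-steps {n} stay down {a} {b' = b'} refl refl da db lt =
  ⊥-elim (+-cancelˡ-≤-contra b' lt
    (≤+k-trans (∣m-n∣≤k⇒n≤m+k a (b' + n) da) (∣m-n∣≤k⇒m≤n+k a b' db)))
shift-kept-short-steps {n} up stay {a} {a' = a'} refl refl da db lt =
  ⊥-elim (+-cancelˡ-≤-contra a lt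
    (≤+k-trans (∣m-n∣≤k⇒m≤n+k (a + n) a' db) (∣m-n∣≤k⇒n≤m+k a a' da)))
shift-kept-short-steps {n} down stay {b = b} {a'} refl refl da db lt =
  ⊥-elim (+-cancelˡ-≤-contra b lt
    (≤+k-trans (∣m-n∣≤k⇒m≤n+k (b + n) a' da) (∣m-n∣≤k⇒n≤m+k b a' db)))
shift-kept-short-steps {n} {k} up down {a} {b' = b'} refl refl da db lt =
  ⊥-elim (+-cancelˡ-≤-contra a k<n
    (≤-trans (∣m-n∣≤k⇒m≤n+k (a + n) b' db)
      (≤-trans (+-monoʳ-≤ b' (<⇒≤ k<n)) (∣m-n∣≤k⇒n≤m+k a (b' + n) da))))
  where
    k<n : k < n
    k<n = ≤-<-trans (m≤m+n k k) lt
shift-kept-short-steps {n} {k} down up {b = b} {a'} refl refl da db lt =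
  ⊥-elim (+-cancelˡ-≤-contra b k<n
    (≤-trans (∣m-n∣≤k⇒m≤n+k (b + n) a' da)
      (≤-trans (+-monoʳ-≤ a' (<⇒≤ k<n)) (∣m-n∣≤k⇒n≤m+k b (a' + n) db))))
  where
    k<n : k < n
    k<n = ≤-<-trans (m≤m+n k k) lt

shift-kept-same-direction : ∀ {n k} t t' {a b a' b'} → Shifted n t a b → Shifted n t' a' b' →
                            a < a' → b < b' → a' ≤ a + k → b' ≤ b + k → k < n → t ≡ t'
shift-kept-same-direction stay stay _ _ _ _ _ _ _ = refl
shift-kept-same-direction up   up   _ _ _ _ _ _ _ = refl
shift-kept-same-direction down down _ _ _ _ _ _ _ = refl
shift-kept-same-direction {k = k} stay up {a' = a'} refl refl a<a' _ _ b'≤ lt =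
  ⊥-elim (+-cancelˡ-≤-contra a' lt (≤-trans b'≤ (+-monoˡ-≤ k (<⇒≤ a<a'))))
shift-kept-same-direction {k = k} stay down {b' = b'} refl refl _ b<b' a'≤ _ lt =
  ⊥-elim (+-cancelˡ-≤-contra b' lt (≤-trans a'≤ (+-monoˡ-≤ k (<⇒≤ b<b'))))
shift-kept-same-direction up stay {a} refl refl _ b<b' a'≤ _ lt =
  ⊥-elim (+-cancelˡ-≤-contra a lt (<⇒≤ (<-≤-trans b<b' a'≤)))
shift-kept-same-direction down stay {b = b} refl refl a<a' _ _ b'≤ lt =
  ⊥-elim (+-cancelˡ-≤-contra b lt (<⇒≤ (<-≤-trans a<a' b'≤)))
shift-kept-same-direction {n} up down {a} {b' = b'} refl refl _ b<b' a'≤ _ lt =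
  ⊥-elim (+-cancelˡ-≤-contra a lt (<⇒≤ (<-≤-trans b<b' (≤-trans (m≤m+n b' n) a'≤))))
shift-kept-same-direction {n} down up {b = b} {a'} refl refl a<a' _ _ b'≤ lt =
  ⊥-elim (+-cancelˡ-≤-contra b lt (<⇒≤ (<-≤-trans a<a' (≤-trans (m≤m+n a' n) b'≤))))

data Flip : Shift → Shift → Set where
  down→stay : Flip down stay
  stay→up   : Flip stay up

shift-flips-opposite-directions :
  ∀ {n k} t t' {a b a' b'} → Shifted n t a b → Shifted n t' a' b' →
  a' < a → b < b' → a ≤ a' + k → b' ≤ b + k → 1 ≤ k → k + k ≡ n →
  Flip t t' × a ≡ a' + k × b' ≡ b + k
shift-flips-opposite-directions stay stay refl refl a'<a b<b' _ _ _ _ =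
  ⊥-elim (<-asym a'<a b<b')
shift-flips-opposite-directions {n} up up {a} {a' = a'} refl refl a'<a b<b' _ _ _ _ =
  ⊥-elim (<-asym a'<a (+-cancelʳ-< n a a' b<b'))
shift-flips-opposite-directions {n} down down {b = b} {b' = b'} refl refl a'<a b<b' _ _ _ _ =
  ⊥-elim (<-asym b<b' (+-cancelʳ-< n b' b a'<a))
shift-flips-opposite-directions {n} stay down {b' = b'} refl refl a'<a b<b' _ _ _ _ =
  ⊥-elim (<-irrefl refl (<-trans (≤-<-trans (m≤m+n b' n) a'<a) b<b'))
shift-flips-opposite-directions {n} up stay {a} refl refl a'<a b<b' _ _ _ _ =
  ⊥-elim (<-irrefl refl (<-trans (<-≤-trans a'<a (m≤m+n a n)) b<b'))
shift-flips-opposite-directions {n} up down {a} {b' = b'} refl refl a'<a b<b' _ _ _ _ =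
  ⊥-elim (<-asym (≤-<-trans (m≤m+n a n) b<b') (≤-<-trans (m≤m+n b' n) a'<a))
shift-flips-opposite-directions {n} {k} down up {b = b} {a'} refl refl _ _ a≤ b'≤ 1≤k k+k≡n =
  ⊥-elim (+-cancelˡ-≤-contra b k<n (<⇒≤ (≤-<-trans a≤ (<-≤-trans (+-monoʳ-< a' k<n) b'≤))))
  where
    k<n : k < n
    k<n = subst (k <_) k+k≡n (m<m+n k 1≤k)
shift-flips-opposite-directions {n} {k} stay up {a} {a' = a'} refl refl _ _ a≤ b'≤ _ k+k≡n =
  stay→up , a≡a'+k , sym a+k≡a'+n
  where
    a'+n≡a'+k+k : a' + n ≡ a' + k + k
    a'+n≡a'+k+k = trans (cong (a' +_) (sym k+k≡n)) (sym (+-assoc a' k k))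
    a+k≡a'+n : a + k ≡ a' + n
    a+k≡a'+n = ≤-antisym (subst (a + k ≤_) (sym a'+n≡a'+k+k) (+-monoˡ-≤ k a≤)) b'≤
    a≡a'+k : a ≡ a' + k
    a≡a'+k = +-cancelʳ-≡ k a (a' + k) (trans a+k≡a'+n a'+n≡a'+k+k)
shift-flips-opposite-directions {n} {k} down stay {b = b} {a'} refl refl _ _ a≤ b'≤ _ k+k≡n =
  down→stay , sym a'+k≡b+n , a'≡b+k
  where
    b+n≡b+k+k : b + n ≡ b + k + k
    b+n≡b+k+k = trans (cong (b +_) (sym k+k≡n)) (sym (+-assoc b k k))
    a'+k≡b+n : a' + k ≡ b + n
    a'+k≡b+n = ≤-antisym (subst (a' + k ≤_) (sym b+n≡b+k+k) (+-monoˡ-≤ k b'≤)) a≤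
    a'≡b+k : a' ≡ b + k
    a'≡b+k = +-cancelʳ-≡ k a' (b + k) (trans a'+k≡b+n b+n≡b+k+k)

2*n≡n+n : ∀ n → 2 * n ≡ n + n
2*n≡n+n n = cong (n +_) (+-identityʳ n)

module _ {R : ℕ → ℕ → Set} (R-trans : ∀ {x y z} → R x y → R y z → R x z)
         {f : ℕ → ℕ} {a b : ℕ} (R-step : ∀ j → a ≤ j → j < b → R (f j) (f (suc j))) where

  stepwise⇒chained : ∀ {c} → a < c → c ≤ b → R (f a) (f c)
  stepwise⇒chained {suc c} a<1+c 1+c≤b with m≤n⇒m<n∨m≡n (s≤s⁻¹ a<1+c)
  ... | inj₂ refl = R-step a ≤-refl 1+c≤b
  ... | inj₁ a<c  = R-trans (stepwise⇒chained a<c (<⇒≤ 1+c≤b)) (R-step c (<⇒≤ a<c) 1+c≤b)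

module BadSequence {k n L r m : ℕ} {i : ℕ → ℕ} (bad : KBad k L (S n) r i m) where

  1≤r : 1 ≤ r
  1≤r = proj₁ bad

  1<m : 1 < m
  1<m = proj₁ (proj₂ bad)

  m≤2r : m ≤ 2 * r
  m≤2r = proj₁ (proj₂ (proj₂ bad))

  in-range : ∀ j → 1 ≤ j → j ≤ 2 * r → 1 ≤ i j × i j ≤ L
  in-range = proj₁ (proj₂ (proj₂ (proj₂ bad)))

  same-symbol : ∀ j → 1 ≤ j → j ≤ r → S n (i j) ≡ S n (i (j + r))
  same-symbol = proj₁ (proj₂ (proj₂ (proj₂ (proj₂ bad))))

  descending : ∀ j → 1 ≤ j → j < m → i (suc j) < i j
  descending = proj₁ (proj₂ (proj₂ (proj₂ (proj₂ (proj₂ bad)))))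

  ascending : ∀ j → m ≤ j → j < 2 * r → i j < i (suc j)
  ascending = proj₁ (proj₂ (proj₂ (proj₂ (proj₂ (proj₂ (proj₂ bad))))))

  short-step : ∀ j → 1 ≤ j → j < 2 * r → ∣ i j - i (suc j) ∣ ≤ k
  short-step = proj₁ (proj₂ (proj₂ (proj₂ (proj₂ (proj₂ (proj₂ (proj₂ bad)))))))

  turn-step : m < 2 * r → i (suc m) < i m + k
  turn-step = proj₂ (proj₂ (proj₂ (proj₂ (proj₂ (proj₂ (proj₂ (proj₂ bad)))))))

  suc-pred-m : suc (pred m) ≡ m
  suc-pred-m = suc-pred m {{>-nonZero (<⇒≤ 1<m)}}

  1≤pred-m : 1 ≤ pred m
  1≤pred-m = s≤s⁻¹ (subst (1 <_) (sym suc-pred-m) 1<m)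

  j≤r⇒j+r≤2r : ∀ {j} → j ≤ r → j + r ≤ 2 * r
  j≤r⇒j+r≤2r {j} j≤r = subst (j + r ≤_) (sym (2*n≡n+n r)) (+-monoˡ-≤ r j≤r)

  r<2r : r < 2 * r
  r<2r = j≤r⇒j+r≤2r 1≤r

  1≤j+r : ∀ j → 1 ≤ j + r
  1≤j+r j = ≤-trans 1≤r (m≤n+m r j)

  first-in-range : 1 ≤ i 1 × i 1 ≤ L
  first-in-range = in-range 1 ≤-refl (<⇒≤ (≤-<-trans 1≤r r<2r))

  last-in-range : 1 ≤ i (r + r) × i (r + r) ≤ L
  last-in-range = in-range (r + r) (1≤j+r r) (j≤r⇒j+r≤2r ≤-refl)

  step-back : ∀ j → 1 ≤ j → j < 2 * r → i j ≤ i (suc j) + k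
  step-back j 1≤j j<2r = ∣m-n∣≤k⇒m≤n+k (i j) (i (suc j)) (short-step j 1≤j j<2r)

  step-forth : ∀ j → 1 ≤ j → j < 2 * r → i (suc j) ≤ i j + k
  step-forth j 1≤j j<2r = ∣m-n∣≤k⇒n≤m+k (i j) (i (suc j)) (short-step j 1≤j j<2r)

  descending-chain : ∀ {a b} → 1 ≤ a → a < b → b ≤ m → i b < i a
  descending-chain 1≤a = stepwise⇒chained {R = _>_} (λ y<x z<y → <-trans z<y y<x) {f = i}
                           (λ j a≤j j<m → descending j (≤-trans 1≤a a≤j) j<m)

  ascending-chain : ∀ {a b} → m ≤ a → a < b → b ≤ 2 * r → i a < i b
  ascending-chain m≤a = stepwise⇒chained {R = _<_} <-trans {f = i}
                          (λ j a≤j → ascending j (≤-trans m≤a a≤j))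

  Pair : Shift → ℕ → Set
  Pair t j = Shifted n t (i j) (i (j + r))

  pair : ∀ j → 1 ≤ j → j ≤ r → ∃ λ t → Pair t j
  pair j 1≤j j≤r = S-≡⇒Shifted n (i j) (i (j + r)) (same-symbol j 1≤j j≤r)

  ShiftKept : ℕ → Set
  ShiftKept j = ∀ {t t'} → Pair t j → Pair t' (suc j) → t ≡ t'

  shift-propagates : ∀ {a b t} → 1 ≤ a → a ≤ b → b ≤ r →
                     (∀ j → a ≤ j → j < b → ShiftKept j) → Pair t a → Pair t b
  shift-propagates {b = zero} 1≤a a≤0 = contradiction (≤-trans 1≤a a≤0) λ ()
  shift-propagates {a} {suc b} {t} 1≤a a≤1+b 1+b≤r kept p with m≤n⇒m<n∨m≡n a≤1+b
  ... | inj₂ refl = p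
  ... | inj₁ a<1+b = subst (λ u → Pair u (suc b)) (sym (kept b a≤b ≤-refl pb p')) p'
    where
      a≤b : a ≤ b
      a≤b = s≤s⁻¹ a<1+b
      pb : Pair t b
      pb = shift-propagates 1≤a a≤b (<⇒≤ 1+b≤r) (λ j a≤j j<b → kept j a≤j (m<n⇒m<1+n j<b)) p
      p' : Pair (proj₁ (pair (suc b) (s≤s z≤n) 1+b≤r)) (suc b)
      p' = proj₂ (pair (suc b) (s≤s z≤n) 1+b≤r)

  module _ (L+k≤n+n : L + k ≤ n + n) where

    fits-below-n : ∀ x → x + n ≤ L → x + k ≤ n
    fits-below-n x x+n≤L = +-cancelʳ-≤ n (x + k) n (begin
      x + k + n  ≡⟨ +-assoc x k n ⟩
      x + (k + n) ≡⟨ cong (x +_) (+-comm k n) ⟩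
      x + (n + k) ≡⟨ +-assoc x n k ⟨
      x + n + k  ≤⟨ +-monoˡ-≤ k x+n≤L ⟩
      L + k      ≤⟨ L+k≤n+n ⟩
      n + n      ∎)
      where open ≤-Reasoning

    ends-differ : ∀ {t} → Pair t 1 → Pair t r → ⊥
    ends-differ {stay} p₁ pᵣ with m ≤? r
    ... | yes m≤r = <-irrefl pᵣ (ascending-chain m≤r (m<m+n r 1≤r) (j≤r⇒j+r≤2r ≤-refl))
    ... | no  m≰r = <-irrefl (sym p₁) (descending-chain ≤-refl (s≤s 1≤r) (≰⇒> m≰r))
    ends-differ {up} p₁ pᵣ = <-irrefl refl (begin-strict
      n             <⟨ +-monoˡ-≤ n (proj₁ first-in-range) ⟩
      i 1 + n       ≡⟨ p₁ ⟩
      i (suc r)     ≤⟨ step-forth r 1≤r r<2r ⟩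
      i r + k       ≤⟨ fits-below-n (i r) (subst (_≤ L) (sym pᵣ) (proj₂ last-in-range)) ⟩
      n             ∎)
      where open ≤-Reasoning
    ends-differ {down} p₁ pᵣ = <-irrefl refl (begin-strict
      n             <⟨ +-monoˡ-≤ n (proj₁ last-in-range) ⟩
      i (r + r) + n ≡⟨ pᵣ ⟩
      i r           ≤⟨ step-back r 1≤r r<2r ⟩
      i (suc r) + k ≤⟨ fits-below-n (i (suc r)) (subst (_≤ L) (sym p₁) (proj₂ first-in-range)) ⟩
      n             ∎)
      where open ≤-Reasoning

    constant-shift-impossible : (∀ j → 1 ≤ j → j < r → ShiftKept j) → ⊥
    constant-shift-impossible kept =
      let (t , p₁) = pair 1 ≤-refl 1≤r
      in ends-differ p₁ (shift-propagates ≤-refl 1≤r ≤-refl kept p₁)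

    no-bad-when-2k<n : k + k < n → ⊥
    no-bad-when-2k<n 2k<n = constant-shift-impossible λ j 1≤j j<r p p' →
      shift-kept-short-steps _ _ p p' (short-step j 1≤j (<-trans j<r r<2r))
        (short-step (j + r) (1≤j+r j) (j≤r⇒j+r≤2r j<r)) 2k<n

  module Tight (1≤k : 1 ≤ k) (k+k≡n : k + k ≡ n) where

    k<n : k < n
    k<n = subst (k <_) k+k≡n (m<m+n k 1≤k)

    flip-across-turn : ∀ {j t t'} → 1 ≤ j → suc j ≤ m → m ≤ j + r → suc j ≤ r →
                       Pair t j → Pair t' (suc j) →
                       Flip t t' × i j ≡ i (suc j) + k × i (suc (j + r)) ≡ i (j + r) + k
    flip-across-turn {j} 1≤j j<m m≤j+r j<r p p' =
      shift-flips-opposite-directions _ _ p p'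
        (descending j 1≤j j<m) (ascending (j + r) m≤j+r (j≤r⇒j+r≤2r j<r))
        (step-back j 1≤j (<-trans j<r r<2r)) (step-forth (j + r) (1≤j+r j) (j≤r⇒j+r≤2r j<r))
        1≤k k+k≡n

    -- If m = 2r all steps below 2r descend in both coordinates; otherwise the flip at
    -- j = m - r makes i (m + 1) = i m + k, against condition (d).
    turn-after-r-impossible : L + k ≤ n + n → r < m → ⊥
    turn-after-r-impossible L+k≤n+n r<m with m≤n⇒m<n∨m≡n m≤2r
    ... | inj₂ m≡2r = constant-shift-impossible L+k≤n+n λ j 1≤j j<r p p' →
      let j+r<m = subst (j + r <_) (sym m≡2r) (j≤r⇒j+r≤2r j<r)
      in sym (shift-kept-same-direction _ _ p' p
           (descending j 1≤j (<-trans j<r r<m)) (descending (j + r) (1≤j+r j) j+r<m)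
           (step-back j 1≤j (<-trans j<r r<2r)) (step-back (j + r) (1≤j+r j) (j≤r⇒j+r≤2r j<r))
           k<n)
    ... | inj₁ m<2r =
      let j = m ∸ r
          j+r≡m : j + r ≡ m
          j+r≡m = m∸n+n≡m (<⇒≤ r<m)
          j<r : j < r
          j<r = +-cancelʳ-< r j r (subst₂ _<_ (sym j+r≡m) (2*n≡n+n r) m<2r)
          (t , p) = pair j (m<n⇒0<n∸m r<m) (<⇒≤ j<r)
          (t' , p') = pair (suc j) (s≤s z≤n) j<r
          (_ , _ , turn) = flip-across-turn (m<n⇒0<n∸m r<m) (≤-trans j<r (<⇒≤ r<m))
                             (≤-reflexive (sym j+r≡m)) j<r p p'
      in <-irrefl (subst (λ x → i (suc x) ≡ i x + k) j+r≡m turn) (turn-step m<2r)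

    module _ (m≤r : m ≤ r) where

      ir<ir+r : i r < i (r + r)
      ir<ir+r = ascending-chain m≤r (m<m+n r 1≤r) (j≤r⇒j+r≤2r ≤-refl)

      shift-up-at-r : ∀ {t} → Pair t r → t ≡ up
      shift-up-at-r {stay} pᵣ = contradiction pᵣ (<⇒≢ ir<ir+r)
      shift-up-at-r {up}   _  = refl
      shift-up-at-r {down} pᵣ = contradiction (subst (i (r + r) ≤_) pᵣ (m≤m+n _ n)) (<⇒≱ ir<ir+r)

      shift-up-at-turn : Pair up m
      shift-up-at-turn =
        subst (λ u → Pair u m) (shift-up-at-r (shift-propagates 1≤m m≤r ≤-refl kept pₘ)) pₘ
        where
          1≤m : 1 ≤ m
          1≤m = <⇒≤ 1<m
          pₘ : Pair (proj₁ (pair m 1≤m m≤r)) m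
          pₘ = proj₂ (pair m 1≤m m≤r)
          kept : ∀ j → m ≤ j → j < r → ShiftKept j
          kept j m≤j j<r p p' = shift-kept-same-direction _ _ p p'
            (ascending j m≤j (<-trans j<r r<2r))
            (ascending (j + r) (≤-trans m≤j (m≤m+n j r)) (j≤r⇒j+r≤2r j<r))
            (step-forth j (≤-trans 1≤m m≤j) (<-trans j<r r<2r))
            (step-forth (j + r) (1≤j+r j) (j≤r⇒j+r≤2r j<r))
            k<n

      flip-below-turn : ∀ {j t t'} → 1 ≤ j → suc j ≤ m → Pair t j → Pair t' (suc j) →
                        Flip t t' × i j ≡ i (suc j) + k × i (suc (j + r)) ≡ i (j + r) + k
      flip-below-turn {j} 1≤j j<m =
        flip-across-turn 1≤j j<m (≤-trans m≤r (m≤n+m r j)) (≤-trans j<m m≤r)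

      no-down-below-turn : ∀ j → suc (suc j) ≤ m → Pair down (suc (suc j)) → ⊥
      no-down-below-turn j j+2≤m p
        with pair (suc j) (s≤s z≤n) (≤-trans (n≤1+n (suc j)) (≤-trans j+2≤m m≤r))
      ... | _ , p' with flip-below-turn {t' = down} (s≤s z≤n) j+2≤m p' p
      ... | () , _

      -- Read downwards from the turn, the shifts are up, stay, down, and nothing flips into down;
      -- so m ≤ 3, where m = 3 would force i (1 + r) = i 3 and r = 2 would violate condition (d).
      stay-below-turn⇒m≡2 : ∀ j → suc j ≡ m → Pair stay j → i j ≡ i (suc j) + k →
                            m ≡ 2 × 2 < r
      stay-below-turn⇒m≡2 zero 1≡m _ _ = contradiction (sym 1≡m) (>⇒≢ 1<m)
      stay-below-turn⇒m≡2 1 2≡m p₁ i₁≡i₂+k with 3 ≤? r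
      ... | yes 2<r = sym 2≡m , 2<r
      ... | no  2≮r = contradiction (subst₂ _<_ i₃≡i₂+k refl i₃<i₂+k) (<-irrefl refl)
        where
          r≡2 : r ≡ 2
          r≡2 = ≤-antisym (s≤s⁻¹ (≰⇒> 2≮r)) (subst (_≤ r) (sym 2≡m) m≤r)
          i₃≡i₂+k : i 3 ≡ i 2 + k
          i₃≡i₂+k = trans (cong (λ x → i (suc x)) (sym r≡2)) (trans (sym p₁) i₁≡i₂+k)
          i₃<i₂+k : i 3 < i 2 + k
          i₃<i₂+k = subst (λ x → i (suc x) < i x + k) (sym 2≡m)
                      (turn-step (subst₂ (λ x y → x < 2 * y) 2≡m (sym r≡2) (s≤s (s≤s (s≤s z≤n)))))
      stay-below-turn⇒m≡2 2 3≡m p₂ i₂≡i₃+k with pair 1 ≤-refl 1≤r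
      ... | _ , p₁
        with flip-below-turn {t' = stay} ≤-refl (≤-trans (n≤1+n 2) (≤-reflexive 3≡m)) p₁ p₂
      ... | down→stay , i₁≡i₂+k , _ =
        contradiction (+-cancelʳ-≡ n _ _ i₁₊ᵣ+n≡i₃+n)
          (>⇒≢ (ascending-chain (≤-reflexive (sym 3≡m))
                  (s≤s (subst (_≤ r) (sym 3≡m) m≤r)) r<2r))
        where
          i₁₊ᵣ+n≡i₃+n : i (suc r) + n ≡ i 3 + n
          i₁₊ᵣ+n≡i₃+n = begin
            i (suc r) + n ≡⟨ p₁ ⟩
            i 1           ≡⟨ i₁≡i₂+k ⟩
            i 2 + k       ≡⟨ cong (_+ k) i₂≡i₃+k ⟩
            i 3 + k + k   ≡⟨ +-assoc (i 3) k k ⟩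
            i 3 + (k + k) ≡⟨ cong (i 3 +_) k+k≡n ⟩
            i 3 + n       ∎
            where open ≡-Reasoning
      stay-below-turn⇒m≡2 (suc (suc (suc j))) j+4≡m p _
        with pair (suc (suc j)) (s≤s z≤n) (≤-trans (m≤n+m _ 2) (≤-trans (≤-reflexive j+4≡m) m≤r))
      ... | _ , p'
        with flip-below-turn {t' = stay} (s≤s z≤n) (≤-trans (n≤1+n _) (≤-reflexive j+4≡m)) p' p
      ... | down→stay , _ =
        ⊥-elim (no-down-below-turn j (≤-trans (m≤n+m _ 2) (≤-reflexive j+4≡m)) p')

      m≡2×2<r : m ≡ 2 × 2 < r
      m≡2×2<r
        with pair (pred m) 1≤pred-m (≤-trans (n≤1+n _) (≤-trans (≤-reflexive suc-pred-m) m≤r))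
      ... | _ , p with flip-below-turn {t' = up} 1≤pred-m (≤-reflexive suc-pred-m) p
                         (subst (λ x → Pair up x) (sym suc-pred-m) shift-up-at-turn)
      ... | stay→up , iⱼ≡iⱼ₊₁+k , _ = stay-below-turn⇒m≡2 (pred m) suc-pred-m p iⱼ≡iⱼ₊₁+k

    m≡2×m<r : L + k ≤ n + n → m ≡ 2 × m < r
    m≡2×m<r L+k≤n+n with m ≤? r
    ... | yes m≤r = let (m≡2 , 2<r) = m≡2×2<r m≤r in m≡2 , subst (_< r) (sym m≡2) 2<r
    ... | no  m≰r = ⊥-elim (turn-after-r-impossible L+k≤n+n (≰⇒> m≰r))

S-wide-special : ∀ {k n} → k + k < n → KSpecial k (n + (n ∸ k)) (S n)
S-wide-special {k} {n} 2k<n r i m bad = BadSequence.no-bad-when-2k<n bad length-bound 2k<n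
  where
    length-bound : n + (n ∸ k) + k ≤ n + n
    length-bound = ≤-reflexive (trans (+-assoc n (n ∸ k) k)
                                       (cong (n +_) (m∸n+n≡m (≤-trans (m≤m+n k k) (<⇒≤ 2k<n)))))

S-tight-bad⇒m≡2×m<r : ∀ {k r m} {i : ℕ → ℕ} → 1 ≤ k → KBad k (2 * k + k) (S (2 * k)) r i m →
                      m ≡ 2 × m < r
S-tight-bad⇒m≡2×m<r {k} 1≤k bad =
  BadSequence.Tight.m≡2×m<r bad 1≤k (sym (2*n≡n+n k)) length-bound
  where
    length-bound : 2 * k + k + k ≤ 2 * k + 2 * k
    length-bound = ≤-reflexive (trans (+-assoc (2 * k) k k) (cong (2 * k +_) (sym (2*n≡n+n k))))

KBad-relabel : ∀ {A B : Set} {k L r m} {i : ℕ → ℕ} (s : ℕ → A) (g : A → B) →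
               (∀ {a b} → 1 ≤ a → a ≤ L → 1 ≤ b → b ≤ L → g (s a) ≡ g (s b) → s a ≡ s b) →
               KBad k L (λ p → g (s p)) r i m → KBad k L s r i m
KBad-relabel {r = r} {i = i} s g g-injective (1≤r , 1<m , m≤2r , in-range , same , rest) =
  1≤r , 1<m , m≤2r , in-range , same′ , rest
  where
    same′ : ∀ j → 1 ≤ j → j ≤ r → s (i j) ≡ s (i (j + r))
    same′ j 1≤j j≤r =
      let (1≤iⱼ , iⱼ≤L) = in-range j 1≤j (≤-trans j≤r (m≤m+n r (r + 0)))
          (1≤iⱼ₊ᵣ , iⱼ₊ᵣ≤L) = in-range (j + r) (≤-trans 1≤j (m≤m+n j r))
                                 (subst (j + r ≤_) (sym (2*n≡n+n r)) (+-monoˡ-≤ r j≤r))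
      in g-injective 1≤iⱼ iⱼ≤L 1≤iⱼ₊ᵣ iⱼ₊ᵣ≤L (same j 1≤j j≤r)

S-in-range : ∀ {n p} → 1 ≤ p → p ≤ n + n → 1 ≤ S n p × S n p ≤ n
S-in-range {n} {p} 1≤p p≤2n with p ≤? n
... | yes p≤n = subst (1 ≤_) (sym (S-low p≤n)) 1≤p , subst (_≤ n) (sym (S-low p≤n)) p≤n
... | no  p≰n =
  +-cancelʳ-< n 0 (S n p) (subst (n <_) (sym Sₚ+n≡p) (≰⇒> p≰n)) ,
  +-cancelʳ-≤ n (S n p) n (subst (_≤ n + n) (sym Sₚ+n≡p) p≤2n)
  where
    Sₚ+n≡p : S n p + n ≡ p
    Sₚ+n≡p = S-high (≰⇒> p≰n)

pred-mod-injective : ∀ {n} .{{_ : NonZero n}} {x y} → 1 ≤ x → x ≤ n → 1 ≤ y → y ≤ n →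
                     pred x mod n ≡ pred y mod n → x ≡ y
pred-mod-injective {n} {suc x} {suc y} _ x<n _ y<n e = cong suc (begin
  x             ≡⟨ m<n⇒m%n≡m x<n ⟨
  x % n         ≡⟨ toℕ-fromℕ< _ ⟨
  toℕ (x mod n) ≡⟨ cong toℕ e ⟩
  toℕ (y mod n) ≡⟨ toℕ-fromℕ< _ ⟩
  y % n         ≡⟨ m<n⇒m%n≡m y<n ⟩
  y             ∎)
  where open ≡-Reasoning

S-as-Fin : ∀ n .{{_ : NonZero n}} → ℕ → Fin n
S-as-Fin n p = pred (S n p) mod n

S-as-Fin-special : ∀ {k n} .{{_ : NonZero n}} → k + k < n →
                   KSpecial k (n + (n ∸ k)) (S-as-Fin n)
S-as-Fin-special {k} {n} 2k<n r i m bad =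
  S-wide-special 2k<n r i m (KBad-relabel (S n) (λ x → pred x mod n) S-injective bad)
  where
    L≤2n : n + (n ∸ k) ≤ n + n
    L≤2n = +-monoʳ-≤ n (m∸n≤m n k)
    S-injective : ∀ {a b} → 1 ≤ a → a ≤ n + (n ∸ k) → 1 ≤ b → b ≤ n + (n ∸ k) →
                  pred (S n a) mod n ≡ pred (S n b) mod n → S n a ≡ S n b
    S-injective 1≤a a≤L 1≤b b≤L =
      let (1≤Sₐ , Sₐ≤n) = S-in-range 1≤a (≤-trans a≤L L≤2n)
          (1≤S_b , S_b≤n) = S-in-range 1≤b (≤-trans b≤L L≤2n)
      in pred-mod-injective 1≤Sₐ Sₐ≤n 1≤S_b S_b≤n

proposition10 : (k n : ℕ) → 1 ≤ k →
    ((2 * k ≤ n →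
        ∀ r i m → KBad k (n + (n ∸ k)) (S n) r i m → n ≡ 2 * k)
     × (∀ r i m → KBad k (2 * k + k) (S (2 * k)) r i m → m ≡ 2 × m < r))
    × (2 * k + 1 ≤ n →
        Σ ℕ (λ L → Σ (ℕ → Fin n) (λ s → KSpecial k L s × 2 * n ∸ k ≤ L)))
proposition10 k n 1≤k =
  (only-tight-has-bad , λ r i m → S-tight-bad⇒m≡2×m<r 1≤k) , long-special-sequence
  where
    only-tight-has-bad : 2 * k ≤ n → ∀ r i m → KBad k (n + (n ∸ k)) (S n) r i m → n ≡ 2 * k
    only-tight-has-bad 2k≤n r i m bad with m≤n⇒m<n∨m≡n 2k≤n
    ... | inj₁ 2k<n = ⊥-elim (S-wide-special (subst (_< n) (2*n≡n+n k) 2k<n) r i m bad)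
    ... | inj₂ 2k≡n = sym 2k≡n

    long-special-sequence : 2 * k + 1 ≤ n →
                            Σ ℕ (λ L → Σ (ℕ → Fin n) (λ s → KSpecial k L s × 2 * n ∸ k ≤ L))
    long-special-sequence 2k+1≤n =
      n + (n ∸ k) , S-as-Fin n , S-as-Fin-special 2k<n ,
      ≤-reflexive (trans (cong (_∸ k) (2*n≡n+n n)) (+-∸-assoc n (≤-trans (m≤m+n k k) (<⇒≤ 2k<n))))
      where
        2k<n : k + k < n
        2k<n = subst (_≤ n) (trans (+-comm (2 * k) 1) (cong suc (2*n≡n+n k))) 2k+1≤n
        instance
          n≢0 : NonZero n
          n≢0 = >-nonZero (≤-trans (m≤n+m 1 (2 * k)) 2k+1≤n)
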